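{- Let $\alpha(k)$ be the largest odd divisor of $k$, $G(n)=\sum_{k=1}^n\frac{n+1-k}{k}\alpha(k)$ and $g(n)=\frac{n(n+2)}{3}-G(n)$. For $r\ge0$ let $x_r=\frac23(2^{2r}-1)$ and $y_r=2x_r$. For positive integers $n$ and $m$ define $\Lambda(n,m)=\max\{g(2^mn+t): 0\le t\le 2^m-1\}$. Then for every positive integer $n$ and every nonnegative integer $m$, $$\Lambda(n,2m+1)=\max\big(g(2^{2m+1}n+y_m),\,g(2^{2m+1}n+x_m)\big),$$ $$\Lambda(n,2m+2)=\max\big(g(2^{2m+2}n+y_m),\,g(2^{2m+2}n+x_{m+1})\big).$$
   Context: $\alpha(k)$ is the largest odd divisor of the positive integer $k$. -}

module Defs where

open import Data.Nat as ℕ using (ℕ; zero; suc; _∸_; _^_)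
open import Data.Nat.Divisibility using (_∣_; _∣?_)
open import Data.Nat.DivMod using () renaming (_/_ to _div_)
open import Data.Integer using (+_)
open import Data.Rational using (ℚ; _/_; _+_; _-_; _⊔_; 0ℚ)
open import Data.List using (List; upTo; filter; map; foldr)
open import Data.Product using (_×_)
open import Relation.Nullary using (¬_)
open import Relation.Nullary.Decidable using (_×-dec_; ¬?)

-- α(k): the largest odd divisor of k (maximum of the odd divisors d of k, 0 ≤ d ≤ k).
-- Only meaningful for k ≥ 1 (then 1 is an odd divisor).
α : ℕ → ℕ
α k = foldr ℕ._⊔_ 0 (filter (λ d → (d ∣? k) ×-dec ¬? (2 ∣? d)) (upTo (suc k)))

-- G(n) = Σ_{k=1}^{n} (n+1-k)/k · α(k)   (k = suc i, i = 0 .. n-1)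
G : ℕ → ℚ
G n = foldr _+_ 0ℚ (map (λ i → (+ ((suc n ∸ suc i) ℕ.* α (suc i))) / suc i) (upTo n))

g : ℕ → ℚ
g n = ((+ (n ℕ.* (n ℕ.+ 2))) / 3) - G n

-- x_r = (2/3)(2^{2r} - 1)  (an integer, since 3 ∣ 4^r - 1),  y_r = 2 x_r
x : ℕ → ℕ
x r = 2 ℕ.* ((2 ^ (2 ℕ.* r) ∸ 1) div 3)

y : ℕ → ℕ
y r = 2 ℕ.* x r

Λ : ℕ → ℕ → ℚ
Λ n m = foldr _⊔_ (g (2 ^ m ℕ.* n)) (map (λ t → g (2 ^ m ℕ.* n ℕ.+ t)) (upTo (2 ^ m)))

-- Write Δg n = g (n + 1) − g n = (2n + 3)/3 − Σ_{k ≤ n+1} α(k)/k.  Splitting that sum into odd k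
-- (where α(k)/k = 1) and even k (where α(2j)/(2j) = α(j)/(2j)) gives Δg (2k+1) = Δg k / 2 + 1/6 and
-- Δg (2k+2) = Δg k / 2 − 1/6, hence g (2k+1) = g k, g (2k+2) = g k + Δg k / 2 + 1/6, and by induction
-- |Δg| ≤ 1/3: g rises after every odd argument and falls after every even positive one.
-- So on the block of 2^M arguments starting at 2^M (k+1) the maximum of g is attained at two offsets
-- a, b where g equals g k + q Δg k + r and g k + (1 − q) Δg k + r, with 1/2 ≤ q ≤ 1.  The block of size
-- 2^(M+1) over k is the union of the level-M blocks over 2k+1 (where g rises, so a dominates) and over
-- 2k+2 (where g falls, so b dominates); the new pair is 2^M + b, a, and these offsets obey the
-- recursions of x_m and y_m.
module Submission where

open import Defs
open import Data.Nat.Base as ℕ using (ℕ; zero; suc; NonZero; z≤n; s≤s)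
open import Data.Product.Base using (Σ; _×_; _,_; proj₁; proj₂)
open import Data.List.Base using (List; foldr; map; filter; upTo; applyUpTo)
open import Data.List.Membership.Propositional using (_∈_)
open import Data.List.Relation.Unary.All as All using (All)
open import Data.List.Properties using (foldr-preservesᵇ; foldr-forcesᵇ)
open import Relation.Binary.Bundles using (TotalPreorder)
open import Algebra.Construct.NaturalChoice.Base using (MaxOperator)
import Algebra.Construct.NaturalChoice.MaxOp as MaxOp
open import Relation.Binary.PropositionalEquality

module FoldrMax {a ℓ₁ ℓ₂} {O : TotalPreorder a ℓ₁ ℓ₂} (maxOp : MaxOperator O) where

  open TotalPreorder O using (_≲_) renaming (Carrier to A; refl to ≲-refl; trans to ≲-trans)
  open MaxOperator maxOp using (_⊔_)
  open MaxOp maxOp using (⊔-lub; x≤x⊔y; x≤y⊔x)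

  foldr-⊔-lub : ∀ {e v} {xs : List A} → e ≲ v → All (_≲ v) xs → foldr _⊔_ e xs ≲ v
  foldr-⊔-lub = foldr-preservesᵇ ⊔-lub

  ≲-foldr-⊔ : ∀ e {xs : List A} {x} → x ∈ xs → x ≲ foldr _⊔_ e xs
  ≲-foldr-⊔ e {xs} = All.lookup (foldr-forcesᵇ split e xs ≲-refl)
    where
    split : ∀ x y → x ⊔ y ≲ foldr _⊔_ e xs → x ≲ foldr _⊔_ e xs × y ≲ foldr _⊔_ e xs
    split x y x⊔y≲ = ≲-trans (x≤x⊔y x y) x⊔y≲ , ≲-trans (x≤y⊔x x y) x⊔y≲

module LargestOddDivisor where

  open import Data.Nat.Base using (_+_; _*_; _≤_)
  open import Data.Nat.Properties using (⊔-operator; ≤-antisym; +-comm; m*n≢0)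
  open import Data.Nat.Divisibility using (_∣_; _∣?_; ∣-refl; ∣-trans; ∣⇒≤; n∣m*n; m∣m*n; _∣0; ∣1⇒≡1; ∣m+n∣m⇒∣n)
  open import Data.Nat.Coprimality using (Coprime; coprime-divisor)
  open import Data.Nat.Primality using (irreducible[2])
  open import Data.List.Membership.Propositional.Properties using (∈-filter⁺; ∈-filter⁻; ∈-upTo⁺)
  open import Data.Sum.Base using (inj₁; inj₂)
  open import Data.Empty using (⊥-elim)
  open import Relation.Nullary using (¬_)
  open import Relation.Unary using (Decidable)
  open import Relation.Nullary.Decidable using (_×-dec_; ¬?)
  open FoldrMax ⊔-operator

  oddDivisor? : ∀ k → Decidable (λ d → d ∣ k × ¬ 2 ∣ d)
  oddDivisor? k d = (d ∣? k) ×-dec ¬? (2 ∣? d)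

  α-lub : ∀ k {b} → (∀ {d} → d ∣ k → ¬ 2 ∣ d → d ≤ b) → α k ≤ b
  α-lub k bound = foldr-⊔-lub {xs = filter (oddDivisor? k) (upTo (suc k))} z≤n (All.tabulate λ d∈ →
    let _ , d∣k , odd = ∈-filter⁻ (oddDivisor? k) {xs = upTo (suc k)} d∈ in bound d∣k odd)

  odd-divisor≤α : ∀ {k d} .{{_ : NonZero k}} → d ∣ k → ¬ 2 ∣ d → d ≤ α k
  odd-divisor≤α {k} d∣k odd = ≲-foldr-⊔ 0 {filter (oddDivisor? k) (upTo (suc k))}
    (∈-filter⁺ (oddDivisor? k) (∈-upTo⁺ (s≤s (∣⇒≤ d∣k))) (d∣k , odd))

  2∤1+2k : ∀ k → ¬ 2 ∣ 1 + 2 * k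
  2∤1+2k k 2∣1+2k with ∣1⇒≡1 (∣m+n∣m⇒∣n (subst (2 ∣_) (+-comm 1 (2 * k)) 2∣1+2k) (m∣m*n k))
  ... | ()

  odd⇒coprime[2] : ∀ {d} → ¬ 2 ∣ d → Coprime d 2
  odd⇒coprime[2] odd (i∣d , i∣2) with irreducible[2] i∣2
  ... | inj₁ i≡1 = i≡1
  ... | inj₂ refl = ⊥-elim (odd i∣d)

  α-odd : ∀ {n} → ¬ 2 ∣ n → α n ≡ n
  α-odd {zero}  odd = ⊥-elim (odd (2 ∣0))
  α-odd {suc n} odd = ≤-antisym (α-lub (suc n) λ d∣n _ → ∣⇒≤ d∣n) (odd-divisor≤α ∣-refl odd)

  α-double : ∀ n .{{_ : NonZero n}} → α (2 * n) ≡ α n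
  α-double n = ≤-antisym
    (α-lub (2 * n) λ d∣2n odd → odd-divisor≤α (coprime-divisor (odd⇒coprime[2] odd) d∣2n) odd)
    (α-lub n λ d∣n odd → odd-divisor≤α {{m*n≢0 2 n}} (∣-trans d∣n (n∣m*n 2)) odd)

module BinaryInduction where

  open import Data.Nat.Base using (_+_; _*_; _<_)
  open import Data.Nat.Properties using (*-suc; m≤m+n; m≤n⇒m≤1+n)
  open import Data.Nat.Induction using (<-rec)

  data Binary : ℕ → Set where
    zero : Binary 0
    1+2* : ∀ k → Binary (1 + 2 * k)
    2+2* : ∀ k → Binary (2 + 2 * k)

  binary : ∀ n → Binary n
  binary zero = zero
  binary (suc n) with binary n
  ... | zero   = 1+2* 0
  ... | 1+2* k = 2+2* k
  ... | 2+2* k = subst Binary (cong suc (*-suc 2 k)) (1+2* (suc k))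

  binary-induction : ∀ {ℓ} (P : ℕ → Set ℓ) → P 0 →
                     (∀ k → P k → P (1 + 2 * k)) → (∀ k → P k → P (2 + 2 * k)) → ∀ n → P n
  binary-induction P P0 P-odd P-even = <-rec P step
    where
    step : ∀ n → (∀ {m} → m < n → P m) → P n
    step n rec with binary n
    ... | zero   = P0
    ... | 1+2* k = P-odd k (rec (s≤s (m≤m+n k _)))
    ... | 2+2* k = P-even k (rec (s≤s (m≤n⇒m≤1+n (m≤m+n k _))))

module Recurrences where

  open import Data.Nat.Base using (_∸_; _<_)
  import Data.Nat.Properties as ℕ
  open import Data.Integer.Base as ℤ using (1ℤ)
  import Data.Integer.Properties as ℤ
  open import Data.Integer.Tactic.RingSolver using (solve-∀)
  open import Data.Rational.Base using (ℚ; 0ℚ; 1ℚ; ½; _≤_; -_; _+_; _*_; _-_; 1/_; _/_)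
  open import Data.Rational.Literals using (fromℤ)
  open import Data.Rational.Properties
    using (≤ᵇ⇒≤; ≤-trans; module ≤-Reasoning; +-comm; +-assoc; *-assoc; *-inverseʳ; +-monoˡ-≤; *-monoʳ-≤-nonNeg;
           toℚᵘ-injective; toℚᵘ-homo-+; toℚᵘ-homo-*; toℚᵘ-fromℚᵘ)
  open import Data.Rational.Unnormalised.Base using (mkℚᵘ; *≡*)
  open import Data.Rational.Unnormalised.Properties using (≃-trans; ≃-sym)
  open import Data.Rational.Solver using (module +-*-Solver)
  open +-*-Solver using (solve; _:+_; _:*_; _:-_; con; _:=_)
  open import Data.Unit.Base using (tt)
  open import Function.Base using (_∘_)
  open LargestOddDivisor using (α-odd; α-double; 2∤1+2k)
  open BinaryInduction using (binary-induction)

  fromℕ : ℕ → ℚ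
  fromℕ n = fromℤ (ℤ.+ n)

  fromℕ-homo-+ : ∀ m n → fromℕ (m ℕ.+ n) ≡ fromℕ m + fromℕ n
  fromℕ-homo-+ m n = toℚᵘ-injective (≃-trans
    (*≡* (trans (cong (ℤ._* (1ℤ ℤ.* 1ℤ)) (ℤ.pos-+ m n)) (lemma (ℤ.+ m) (ℤ.+ n))))
    (≃-sym (toℚᵘ-homo-+ (fromℕ m) (fromℕ n))))
    where
    lemma : ∀ a b → (a ℤ.+ b) ℤ.* (1ℤ ℤ.* 1ℤ) ≡ (a ℤ.* 1ℤ ℤ.+ b ℤ.* 1ℤ) ℤ.* 1ℤ
    lemma = solve-∀

  fromℕ-homo-* : ∀ m n → fromℕ (m ℕ.* n) ≡ fromℕ m * fromℕ n
  fromℕ-homo-* m n = toℚᵘ-injective (≃-trans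
    (*≡* (trans (cong (ℤ._* (1ℤ ℤ.* 1ℤ)) (ℤ.pos-* m n)) (lemma (ℤ.+ m) (ℤ.+ n))))
    (≃-sym (toℚᵘ-homo-* (fromℕ m) (fromℕ n))))
    where
    lemma : ∀ a b → a ℤ.* b ℤ.* (1ℤ ℤ.* 1ℤ) ≡ a ℤ.* b ℤ.* 1ℤ
    lemma = solve-∀

  fromℕ-suc : ∀ n → fromℕ (suc n) ≡ 1ℚ + fromℕ n
  fromℕ-suc = fromℕ-homo-+ 1

  fromℕ-1+2k : ∀ k → fromℕ (1 ℕ.+ 2 ℕ.* k) ≡ 1ℚ + fromℕ 2 * fromℕ k
  fromℕ-1+2k k = trans (fromℕ-suc (2 ℕ.* k)) (cong (1ℚ +_) (fromℕ-homo-* 2 k))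

  +m/n≡m*1/n : ∀ m n → ℤ.+ m / suc n ≡ fromℕ m * 1/ fromℕ (suc n)
  +m/n≡m*1/n m n = toℚᵘ-injective (≃-trans (toℚᵘ-fromℚᵘ (mkℚᵘ (ℤ.+ m) n))
    (≃-trans (*≡* (lemma (ℤ.+ m) (ℤ.+ suc n))) (≃-sym (toℚᵘ-homo-* (fromℕ m) (1/ fromℕ (suc n))))))
    where
    lemma : ∀ a b → a ℤ.* (1ℤ ℤ.* b) ≡ a ℤ.* 1ℤ ℤ.* b
    lemma = solve-∀

  1/[2+2n]≡1/[1+n]*½ : ∀ n → 1/ fromℕ (2 ℕ.+ 2 ℕ.* n) ≡ 1/ fromℕ (suc n) * ½
  1/[2+2n]≡1/[1+n]*½ n = toℚᵘ-injective (≃-trans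
    (*≡* (trans (lemma (ℤ.+ suc n)) (cong ((1ℤ ℤ.* 1ℤ) ℤ.*_) (sym 2+2n≡2*[1+n]))))
    (≃-sym (toℚᵘ-homo-* (1/ fromℕ (suc n)) ½)))
    where
    lemma : ∀ a → 1ℤ ℤ.* (a ℤ.* ℤ.+ 2) ≡ (1ℤ ℤ.* 1ℤ) ℤ.* (ℤ.+ 2 ℤ.* a)
    lemma = solve-∀
    2+2n≡2*[1+n] : ℤ.+ (2 ℕ.+ 2 ℕ.* n) ≡ ℤ.+ 2 ℤ.* ℤ.+ suc n
    2+2n≡2*[1+n] = trans (cong ℤ.+_ (sym (ℕ.*-suc 2 n))) (ℤ.pos-* 2 (suc n))

  ∑< : ℕ → (ℕ → ℚ) → ℚ
  ∑< zero    f = 0ℚ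
  ∑< (suc n) f = ∑< n f + f n

  ∑<-shift : ∀ n f → ∑< (suc n) f ≡ f 0 + ∑< n (f ∘ suc)
  ∑<-shift zero    f = +-comm 0ℚ (f 0)
  ∑<-shift (suc n) f = trans (cong (_+ f (suc n)) (∑<-shift n f)) (+-assoc (f 0) (∑< n (f ∘ suc)) (f (suc n)))

  foldr-+-applyUpTo : ∀ (f : ℕ → ℚ) h n → foldr _+_ 0ℚ (map f (applyUpTo h n)) ≡ ∑< n (f ∘ h)
  foldr-+-applyUpTo f h zero    = refl
  foldr-+-applyUpTo f h (suc n) =
    trans (cong (_+_ (f (h 0))) (foldr-+-applyUpTo f (h ∘ suc) n)) (sym (∑<-shift n (f ∘ h)))

  ∑<-cong : ∀ n {f g} → (∀ {i} → i < n → f i ≡ g i) → ∑< n f ≡ ∑< n g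
  ∑<-cong zero    f≡g = refl
  ∑<-cong (suc n) f≡g = cong₂ _+_ (∑<-cong n (f≡g ∘ ℕ.m<n⇒m<1+n)) (f≡g ℕ.≤-refl)

  ∑<-distrib-+ : ∀ n f g → ∑< n (λ i → f i + g i) ≡ ∑< n f + ∑< n g
  ∑<-distrib-+ zero    f g = refl
  ∑<-distrib-+ (suc n) f g = trans (cong (_+ (f n + g n)) (∑<-distrib-+ n f g))
    (solve 4 (λ a b c d → (a :+ b) :+ (c :+ d) := (a :+ c) :+ (b :+ d)) refl (∑< n f) (∑< n g) (f n) (g n))

  ⅓ ⅙ : ℚ
  ⅓ = ℤ.+ 1 / 3
  ⅙ = ℤ.+ 1 / 6

  h : ℕ → ℚ
  h i = ℤ.+ α (suc i) / suc i

  H : ℕ → ℚ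
  H n = ∑< n h

  h-2k : ∀ k → h (2 ℕ.* k) ≡ 1ℚ
  h-2k k = begin
    ℤ.+ α (1 ℕ.+ 2 ℕ.* k) / (1 ℕ.+ 2 ℕ.* k)            ≡⟨ cong (λ a → ℤ.+ a / (1 ℕ.+ 2 ℕ.* k)) (α-odd (2∤1+2k k)) ⟩
    ℤ.+ (1 ℕ.+ 2 ℕ.* k) / (1 ℕ.+ 2 ℕ.* k)              ≡⟨ +m/n≡m*1/n (1 ℕ.+ 2 ℕ.* k) (2 ℕ.* k) ⟩
    fromℕ (1 ℕ.+ 2 ℕ.* k) * 1/ fromℕ (1 ℕ.+ 2 ℕ.* k)   ≡⟨ *-inverseʳ (fromℕ (1 ℕ.+ 2 ℕ.* k)) ⟩
    1ℚ                                                ∎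
    where open ≡-Reasoning

  h-1+2k : ∀ k → h (1 ℕ.+ 2 ℕ.* k) ≡ h k * ½
  h-1+2k k = begin
    ℤ.+ α (2 ℕ.+ 2 ℕ.* k) / (2 ℕ.+ 2 ℕ.* k)         ≡⟨ cong (λ a → ℤ.+ a / (2 ℕ.+ 2 ℕ.* k)) α[2+2k]≡α[1+k] ⟩
    ℤ.+ α (suc k) / (2 ℕ.+ 2 ℕ.* k)                 ≡⟨ +m/n≡m*1/n (α (suc k)) (1 ℕ.+ 2 ℕ.* k) ⟩
    fromℕ (α (suc k)) * 1/ fromℕ (2 ℕ.+ 2 ℕ.* k)    ≡⟨ cong (fromℕ (α (suc k)) *_) (1/[2+2n]≡1/[1+n]*½ k) ⟩
    fromℕ (α (suc k)) * (1/ fromℕ (suc k) * ½)      ≡⟨ *-assoc (fromℕ (α (suc k))) (1/ fromℕ (suc k)) ½ ⟨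
    fromℕ (α (suc k)) * 1/ fromℕ (suc k) * ½        ≡⟨ cong (_* ½) (+m/n≡m*1/n (α (suc k)) k) ⟨
    h k * ½                                         ∎
    where
    open ≡-Reasoning
    α[2+2k]≡α[1+k] : α (2 ℕ.+ 2 ℕ.* k) ≡ α (suc k)
    α[2+2k]≡α[1+k] = trans (cong α (sym (ℕ.*-suc 2 k))) (α-double (suc k))

  H-2k : ∀ k → H (2 ℕ.* k) ≡ fromℕ k + H k * ½
  H-2k zero    = refl
  H-2k (suc k) = begin
    H (2 ℕ.* suc k)                                   ≡⟨ cong H (ℕ.*-suc 2 k) ⟩
    H (2 ℕ.* k) + h (2 ℕ.* k) + h (1 ℕ.+ 2 ℕ.* k)     ≡⟨ cong₂ (λ x y → x + y + h (1 ℕ.+ 2 ℕ.* k)) (H-2k k) (h-2k k) ⟩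
    fromℕ k + H k * ½ + 1ℚ + h (1 ℕ.+ 2 ℕ.* k)        ≡⟨ cong (_+_ (fromℕ k + H k * ½ + 1ℚ)) (h-1+2k k) ⟩
    fromℕ k + H k * ½ + 1ℚ + h k * ½                  ≡⟨ solve 3 (λ x s t → x :+ s :* con ½ :+ con 1ℚ :+ t :* con ½
                                                                := con 1ℚ :+ x :+ (s :+ t) :* con ½) refl (fromℕ k) (H k) (h k) ⟩
    1ℚ + fromℕ k + H (suc k) * ½                      ≡⟨ cong (_+ H (suc k) * ½) (fromℕ-suc k) ⟨
    fromℕ (suc k) + H (suc k) * ½                     ∎
    where open ≡-Reasoning

  H-2+2k : ∀ k → H (2 ℕ.+ 2 ℕ.* k) ≡ 1ℚ + fromℕ k + H (suc k) * ½
  H-2+2k k = trans (cong H (sym (ℕ.*-suc 2 k))) (trans (H-2k (suc k)) (cong (_+ H (suc k) * ½) (fromℕ-suc k)))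

  G≡∑< : ∀ n → G n ≡ ∑< n (λ i → fromℕ (n ∸ i) * h i)
  G≡∑< n = trans (foldr-+-applyUpTo _ (λ i → i) n) (∑<-cong n (λ {i} _ → term i))
    where
    open ≡-Reasoning
    term : ∀ i → ℤ.+ ((n ∸ i) ℕ.* α (suc i)) / suc i ≡ fromℕ (n ∸ i) * h i
    term i = begin
      ℤ.+ ((n ∸ i) ℕ.* α (suc i)) / suc i                  ≡⟨ +m/n≡m*1/n ((n ∸ i) ℕ.* α (suc i)) i ⟩
      fromℕ ((n ∸ i) ℕ.* α (suc i)) * 1/ fromℕ (suc i)     ≡⟨ cong (_* 1/ fromℕ (suc i)) (fromℕ-homo-* (n ∸ i) (α (suc i))) ⟩
      fromℕ (n ∸ i) * fromℕ (α (suc i)) * 1/ fromℕ (suc i) ≡⟨ *-assoc (fromℕ (n ∸ i)) (fromℕ (α (suc i))) (1/ fromℕ (suc i)) ⟩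
      fromℕ (n ∸ i) * (fromℕ (α (suc i)) * 1/ fromℕ (suc i)) ≡⟨ cong (fromℕ (n ∸ i) *_) (+m/n≡m*1/n (α (suc i)) i) ⟨
      fromℕ (n ∸ i) * h i                                  ∎

  G-suc : ∀ n → G (suc n) ≡ G n + H (suc n)
  G-suc n = begin
    G (suc n)                                                      ≡⟨ G≡∑< (suc n) ⟩
    ∑< n (λ i → fromℕ (suc n ∸ i) * h i) + fromℕ (suc n ∸ n) * h n ≡⟨ cong₂ _+_ (∑<-cong n one-more) (cong (λ c → fromℕ c * h n) (ℕ.m+n∸n≡m 1 n)) ⟩
    ∑< n (λ i → fromℕ (n ∸ i) * h i + h i) + fromℕ 1 * h n         ≡⟨ cong (_+ fromℕ 1 * h n) (∑<-distrib-+ n _ h) ⟩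
    ∑< n (λ i → fromℕ (n ∸ i) * h i) + H n + fromℕ 1 * h n         ≡⟨ cong (λ x → x + H n + fromℕ 1 * h n) (G≡∑< n) ⟨
    G n + H n + fromℕ 1 * h n                                      ≡⟨ solve 3 (λ a b c → a :+ b :+ con 1ℚ :* c := a :+ (b :+ c)) refl (G n) (H n) (h n) ⟩
    G n + H (suc n)                                                ∎
    where
    open ≡-Reasoning
    one-more : ∀ {i} → i < n → fromℕ (suc n ∸ i) * h i ≡ fromℕ (n ∸ i) * h i + h i
    one-more {i} i<n = begin
      fromℕ (suc n ∸ i) * h i      ≡⟨ cong (λ c → fromℕ c * h i) (ℕ.+-∸-assoc 1 (ℕ.<⇒≤ i<n)) ⟩
      fromℕ (suc (n ∸ i)) * h i    ≡⟨ cong (_* h i) (fromℕ-suc (n ∸ i)) ⟩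
      (1ℚ + fromℕ (n ∸ i)) * h i   ≡⟨ solve 2 (λ c x → (con 1ℚ :+ c) :* x := c :* x :+ x) refl (fromℕ (n ∸ i)) (h i) ⟩
      fromℕ (n ∸ i) * h i + h i    ∎

  g≡ : ∀ n → g n ≡ fromℕ n * (fromℕ n + fromℕ 2) * ⅓ - G n
  g≡ n = cong (_- G n) (begin
    ℤ.+ (n ℕ.* (n ℕ.+ 2)) / 3             ≡⟨ +m/n≡m*1/n (n ℕ.* (n ℕ.+ 2)) 2 ⟩
    fromℕ (n ℕ.* (n ℕ.+ 2)) * ⅓           ≡⟨ cong (_* ⅓) (fromℕ-homo-* n (n ℕ.+ 2)) ⟩
    fromℕ n * fromℕ (n ℕ.+ 2) * ⅓         ≡⟨ cong (λ x → fromℕ n * x * ⅓) (fromℕ-homo-+ n 2) ⟩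
    fromℕ n * (fromℕ n + fromℕ 2) * ⅓     ∎)
    where open ≡-Reasoning

  Δg : ℕ → ℚ
  Δg n = g (suc n) - g n

  Δg0≡0 : Δg 0 ≡ 0ℚ
  Δg0≡0 = refl

  g-suc : ∀ n → g (suc n) ≡ g n + Δg n
  g-suc n = solve 2 (λ a b → b := a :+ (b :- a)) refl (g n) (g (suc n))

  Δg≡ : ∀ n → Δg n ≡ (fromℕ 2 * fromℕ n + fromℕ 3) * ⅓ - H (suc n)
  Δg≡ n = begin
    g (suc n) - g n
      ≡⟨ cong₂ _-_ (g≡ (suc n)) (g≡ n) ⟩
    fromℕ (suc n) * (fromℕ (suc n) + fromℕ 2) * ⅓ - G (suc n) - (fromℕ n * (fromℕ n + fromℕ 2) * ⅓ - G n)
      ≡⟨ cong₂ (λ x y → x * (x + fromℕ 2) * ⅓ - y - (fromℕ n * (fromℕ n + fromℕ 2) * ⅓ - G n)) (fromℕ-suc n) (G-suc n) ⟩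
    (1ℚ + fromℕ n) * (1ℚ + fromℕ n + fromℕ 2) * ⅓ - (G n + H (suc n)) - (fromℕ n * (fromℕ n + fromℕ 2) * ⅓ - G n)
      ≡⟨ solve 3 (λ x G′ H′ → (con 1ℚ :+ x) :* (con 1ℚ :+ x :+ con (fromℕ 2)) :* con ⅓ :- (G′ :+ H′) :- (x :* (x :+ con (fromℕ 2)) :* con ⅓ :- G′)
                            := (con (fromℕ 2) :* x :+ con (fromℕ 3)) :* con ⅓ :- H′) refl (fromℕ n) (G n) (H (suc n)) ⟩
    (fromℕ 2 * fromℕ n + fromℕ 3) * ⅓ - H (suc n)
      ∎
    where open ≡-Reasoning

  Δg-1+2k : ∀ k → Δg (1 ℕ.+ 2 ℕ.* k) ≡ Δg k * ½ + ⅙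
  Δg-1+2k k = begin
    Δg (1 ℕ.+ 2 ℕ.* k)
      ≡⟨ Δg≡ (1 ℕ.+ 2 ℕ.* k) ⟩
    (fromℕ 2 * fromℕ (1 ℕ.+ 2 ℕ.* k) + fromℕ 3) * ⅓ - H (2 ℕ.+ 2 ℕ.* k)
      ≡⟨ cong₂ (λ x y → (fromℕ 2 * x + fromℕ 3) * ⅓ - y) (fromℕ-1+2k k) (H-2+2k k) ⟩
    (fromℕ 2 * (1ℚ + fromℕ 2 * fromℕ k) + fromℕ 3) * ⅓ - (1ℚ + fromℕ k + H (suc k) * ½)
      ≡⟨ solve 2 (λ x s → (con (fromℕ 2) :* (con 1ℚ :+ con (fromℕ 2) :* x) :+ con (fromℕ 3)) :* con ⅓ :- (con 1ℚ :+ x :+ s :* con ½)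
                        := ((con (fromℕ 2) :* x :+ con (fromℕ 3)) :* con ⅓ :- s) :* con ½ :+ con ⅙) refl (fromℕ k) (H (suc k)) ⟩
    ((fromℕ 2 * fromℕ k + fromℕ 3) * ⅓ - H (suc k)) * ½ + ⅙
      ≡⟨ cong (λ x → x * ½ + ⅙) (Δg≡ k) ⟨
    Δg k * ½ + ⅙
      ∎
    where open ≡-Reasoning

  Δg-2+2k : ∀ k → Δg (2 ℕ.+ 2 ℕ.* k) ≡ Δg k * ½ - ⅙
  Δg-2+2k k = begin
    Δg (2 ℕ.+ 2 ℕ.* k)
      ≡⟨ Δg≡ (2 ℕ.+ 2 ℕ.* k) ⟩
    (fromℕ 2 * fromℕ (2 ℕ.+ 2 ℕ.* k) + fromℕ 3) * ⅓ - (H (2 ℕ.+ 2 ℕ.* k) + h (2 ℕ.+ 2 ℕ.* k))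
      ≡⟨ cong₂ (λ x y → (fromℕ 2 * x + fromℕ 3) * ⅓ - y) fromℕ-2+2k (cong₂ _+_ (H-2+2k k) h-2+2k) ⟩
    (fromℕ 2 * (1ℚ + (1ℚ + fromℕ 2 * fromℕ k)) + fromℕ 3) * ⅓ - (1ℚ + fromℕ k + H (suc k) * ½ + 1ℚ)
      ≡⟨ solve 2 (λ x s → (con (fromℕ 2) :* (con 1ℚ :+ (con 1ℚ :+ con (fromℕ 2) :* x)) :+ con (fromℕ 3)) :* con ⅓ :- (con 1ℚ :+ x :+ s :* con ½ :+ con 1ℚ)
                        := ((con (fromℕ 2) :* x :+ con (fromℕ 3)) :* con ⅓ :- s) :* con ½ :- con ⅙) refl (fromℕ k) (H (suc k)) ⟩
    ((fromℕ 2 * fromℕ k + fromℕ 3) * ⅓ - H (suc k)) * ½ - ⅙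
      ≡⟨ cong (λ x → x * ½ - ⅙) (Δg≡ k) ⟨
    Δg k * ½ - ⅙
      ∎
    where
    open ≡-Reasoning
    fromℕ-2+2k : fromℕ (2 ℕ.+ 2 ℕ.* k) ≡ 1ℚ + (1ℚ + fromℕ 2 * fromℕ k)
    fromℕ-2+2k = trans (fromℕ-suc (1 ℕ.+ 2 ℕ.* k)) (cong (1ℚ +_) (fromℕ-1+2k k))
    h-2+2k : h (2 ℕ.+ 2 ℕ.* k) ≡ 1ℚ
    h-2+2k = trans (cong h (sym (ℕ.*-suc 2 k))) (h-2k (suc k))

  g-1+2k : ∀ k → g (1 ℕ.+ 2 ℕ.* k) ≡ g k
  g-1+2k zero    = refl
  g-1+2k (suc k) = begin
    g (1 ℕ.+ 2 ℕ.* suc k)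
      ≡⟨ cong (g ∘ suc) (ℕ.*-suc 2 k) ⟩
    g (3 ℕ.+ 2 ℕ.* k)
      ≡⟨ solve 3 (λ a b c → c := a :+ (b :- a) :+ (c :- b)) refl (g (1 ℕ.+ 2 ℕ.* k)) (g (2 ℕ.+ 2 ℕ.* k)) (g (3 ℕ.+ 2 ℕ.* k)) ⟩
    g (1 ℕ.+ 2 ℕ.* k) + Δg (1 ℕ.+ 2 ℕ.* k) + Δg (2 ℕ.+ 2 ℕ.* k)
      ≡⟨ cong₂ _+_ (cong₂ _+_ (g-1+2k k) (Δg-1+2k k)) (Δg-2+2k k) ⟩
    g k + (Δg k * ½ + ⅙) + (Δg k * ½ - ⅙)
      ≡⟨ solve 2 (λ a d → a :+ (d :* con ½ :+ con ⅙) :+ (d :* con ½ :- con ⅙) := a :+ d) refl (g k) (Δg k) ⟩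
    g k + Δg k
      ≡⟨ g-suc k ⟨
    g (suc k)
      ∎
    where open ≡-Reasoning

  g-2+2k : ∀ k → g (2 ℕ.+ 2 ℕ.* k) ≡ g k + Δg k * ½ + ⅙
  g-2+2k k = begin
    g (2 ℕ.+ 2 ℕ.* k)                          ≡⟨ g-suc (1 ℕ.+ 2 ℕ.* k) ⟩
    g (1 ℕ.+ 2 ℕ.* k) + Δg (1 ℕ.+ 2 ℕ.* k)     ≡⟨ cong₂ _+_ (g-1+2k k) (Δg-1+2k k) ⟩
    g k + (Δg k * ½ + ⅙)                       ≡⟨ +-assoc (g k) (Δg k * ½) ⅙ ⟨
    g k + Δg k * ½ + ⅙                         ∎
    where open ≡-Reasoning

  *½+-monoˡ-≤ : ∀ c {d e} → d ≤ e → d * ½ + c ≤ e * ½ + c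
  *½+-monoˡ-≤ c d≤e = +-monoˡ-≤ c (*-monoʳ-≤-nonNeg ½ d≤e)

  Within⅓ : ℚ → Set
  Within⅓ d = - ⅓ ≤ d × d ≤ ⅓

  halve±⅙-bounds : ∀ {d} → Within⅓ d → (0ℚ ≤ d * ½ + ⅙ × d * ½ + ⅙ ≤ ⅓) × (- ⅓ ≤ d * ½ - ⅙ × d * ½ - ⅙ ≤ 0ℚ)
  halve±⅙-bounds {d} (lo , hi) =
      ( (begin 0ℚ         ≡⟨ refl ⟩ - ⅓ * ½ + ⅙   ≤⟨ *½+-monoˡ-≤ ⅙ lo ⟩ d * ½ + ⅙ ∎)
      , (begin d * ½ + ⅙  ≤⟨ *½+-monoˡ-≤ ⅙ hi ⟩ ⅓ * ½ + ⅙     ≡⟨ refl ⟩ ⅓ ∎) )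
    , ( (begin - ⅓        ≡⟨ refl ⟩ - ⅓ * ½ - ⅙   ≤⟨ *½+-monoˡ-≤ (- ⅙) lo ⟩ d * ½ - ⅙ ∎)
      , (begin d * ½ - ⅙  ≤⟨ *½+-monoˡ-≤ (- ⅙) hi ⟩ ⅓ * ½ - ⅙ ≡⟨ refl ⟩ 0ℚ ∎) )
    where open ≤-Reasoning

  Δg-bounded : ∀ n → Within⅓ (Δg n)
  Δg-bounded = binary-induction (Within⅓ ∘ Δg) (subst Within⅓ (sym Δg0≡0) (-⅓≤0 , 0≤⅓)) odd even
    where
    -⅓≤0 : - ⅓ ≤ 0ℚ
    -⅓≤0 = ≤ᵇ⇒≤ tt
    0≤⅓ : 0ℚ ≤ ⅓
    0≤⅓ = ≤ᵇ⇒≤ tt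
    odd : ∀ k → Within⅓ (Δg k) → Within⅓ (Δg (1 ℕ.+ 2 ℕ.* k))
    odd k bounds = let (0≤Δ , Δ≤⅓) , _ = halve±⅙-bounds bounds in
      subst Within⅓ (sym (Δg-1+2k k)) (≤-trans -⅓≤0 0≤Δ , Δ≤⅓)
    even : ∀ k → Within⅓ (Δg k) → Within⅓ (Δg (2 ℕ.+ 2 ℕ.* k))
    even k bounds = let _ , (-⅓≤Δ , Δ≤0) = halve±⅙-bounds bounds in
      subst Within⅓ (sym (Δg-2+2k k)) (-⅓≤Δ , ≤-trans Δ≤0 0≤⅓)

  0≤Δg-1+2k : ∀ k → 0ℚ ≤ Δg (1 ℕ.+ 2 ℕ.* k)
  0≤Δg-1+2k k = subst (0ℚ ≤_) (sym (Δg-1+2k k)) (proj₁ (proj₁ (halve±⅙-bounds (Δg-bounded k))))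

  Δg-2+2k≤0 : ∀ k → Δg (2 ℕ.+ 2 ℕ.* k) ≤ 0ℚ
  Δg-2+2k≤0 k = subst (_≤ 0ℚ) (sym (Δg-2+2k k)) (proj₂ (proj₂ (halve±⅙-bounds (Δg-bounded k))))

module BlockMaxima where

  open import Data.Nat.Base using (_^_; _<_; _∸_)
  import Data.Nat.Properties as ℕ
  open import Data.Nat.Tactic.RingSolver using (solve-∀)
  open import Data.Rational.Base using (ℚ; 0ℚ; 1ℚ; ½; _≤_; _+_; _*_; _-_; _⊔_; nonNegative; nonPositive)
  open import Data.Rational.Properties
    using (≤-refl; ≤-trans; ≤-reflexive; ≤-antisym; ≤ᵇ⇒≤; +-monoʳ-≤; +-monoˡ-≤; *-monoʳ-≤-nonNeg; *-monoʳ-≤-nonPos;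
           neg-antimono-≤; +-identityʳ; *-comm;
           ⊔-operator; ⊔-lub; p≤p⊔q; p≤q⊔p; p≤q⇒p⊔q≡q; p≥q⇒p⊔q≡p; module ≤-Reasoning)
  open import Data.Rational.Solver using (module +-*-Solver)
  open +-*-Solver using (solve; _:+_; _:*_; _:-_; con; _:=_)
  open import Data.List.Relation.Unary.All.Properties using (map⁺; applyUpTo⁺₁)
  open import Data.List.Membership.Propositional.Properties using (∈-map⁺; ∈-upTo⁺)
  open import Data.Sum.Base using (_⊎_; inj₁; inj₂)
  open import Data.Unit.Base using (tt)
  open import Relation.Nullary using (yes; no)
  open Recurrences using (⅙; Δg; g-suc; g-1+2k; g-2+2k; Δg-1+2k; Δg-2+2k; 0≤Δg-1+2k; Δg-2+2k≤0)

  chord : ℚ → ℕ → ℚ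
  chord p k = g k + p * Δg k

  chord-mono-≤ : ∀ {p p′} k → p ≤ p′ → 0ℚ ≤ Δg k → chord p k ≤ chord p′ k
  chord-mono-≤ k p≤p′ 0≤Δ = +-monoʳ-≤ (g k) (*-monoʳ-≤-nonNeg (Δg k) {{nonNegative 0≤Δ}} p≤p′)

  chord-anti-≤ : ∀ {p p′} k → p ≤ p′ → Δg k ≤ 0ℚ → chord p′ k ≤ chord p k
  chord-anti-≤ k p≤p′ Δ≤0 = +-monoʳ-≤ (g k) (*-monoʳ-≤-nonPos (Δg k) {{nonPositive Δ≤0}} p≤p′)

  chord-1+2k : ∀ q r k → chord q (1 ℕ.+ 2 ℕ.* k) + r ≡ chord (1ℚ - (1ℚ - q * ½)) k + (r + q * ⅙)
  chord-1+2k q r k = begin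
    g (1 ℕ.+ 2 ℕ.* k) + q * Δg (1 ℕ.+ 2 ℕ.* k) + r
      ≡⟨ cong₂ (λ x d → x + q * d + r) (g-1+2k k) (Δg-1+2k k) ⟩
    g k + q * (Δg k * ½ + ⅙) + r
      ≡⟨ solve 4 (λ G D q r → G :+ q :* (D :* con ½ :+ con ⅙) :+ r
                            := G :+ (con 1ℚ :- (con 1ℚ :- q :* con ½)) :* D :+ (r :+ q :* con ⅙)) refl (g k) (Δg k) q r ⟩
    chord (1ℚ - (1ℚ - q * ½)) k + (r + q * ⅙)
      ∎
    where open ≡-Reasoning

  chord-2+2k : ∀ q r k → chord (1ℚ - q) (2 ℕ.+ 2 ℕ.* k) + r ≡ chord (1ℚ - q * ½) k + (r + q * ⅙)
  chord-2+2k q r k = begin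
    g (2 ℕ.+ 2 ℕ.* k) + (1ℚ - q) * Δg (2 ℕ.+ 2 ℕ.* k) + r
      ≡⟨ cong₂ (λ x d → x + (1ℚ - q) * d + r) (g-2+2k k) (Δg-2+2k k) ⟩
    g k + Δg k * ½ + ⅙ + (1ℚ - q) * (Δg k * ½ - ⅙) + r
      ≡⟨ solve 4 (λ G D q r → G :+ D :* con ½ :+ con ⅙ :+ (con 1ℚ :- q) :* (D :* con ½ :- con ⅙) :+ r
                            := G :+ (con 1ℚ :- q :* con ½) :* D :+ (r :+ q :* con ⅙)) refl (g k) (Δg k) q r ⟩
    chord (1ℚ - q * ½) k + (r + q * ⅙)
      ∎
    where open ≡-Reasoning

  1-q≤q : ∀ {q} → ½ ≤ q → 1ℚ - q ≤ q
  1-q≤q {q} ½≤q = begin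
    1ℚ - q   ≤⟨ +-monoʳ-≤ 1ℚ (neg-antimono-≤ ½≤q) ⟩
    1ℚ - ½   ≡⟨ refl ⟩
    ½        ≤⟨ ½≤q ⟩
    q        ∎
    where open ≤-Reasoning

  1-*½-antimono : ∀ {p q} → p ≤ q → 1ℚ - q * ½ ≤ 1ℚ - p * ½
  1-*½-antimono p≤q = +-monoʳ-≤ 1ℚ (neg-antimono-≤ (*-monoʳ-≤-nonNeg ½ p≤q))

  ½≤1-q*½ : ∀ {q} → q ≤ 1ℚ → ½ ≤ 1ℚ - q * ½
  ½≤1-q*½ {q} q≤1 = begin
    ½              ≡⟨ refl ⟩
    1ℚ - 1ℚ * ½    ≤⟨ 1-*½-antimono q≤1 ⟩
    1ℚ - q * ½     ∎
    where open ≤-Reasoning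

  1-q*½≤1 : ∀ {q} → 0ℚ ≤ q → 1ℚ - q * ½ ≤ 1ℚ
  1-q*½≤1 {q} 0≤q = begin
    1ℚ - q * ½     ≤⟨ 1-*½-antimono 0≤q ⟩
    1ℚ - 0ℚ * ½    ≡⟨ refl ⟩
    1ℚ             ∎
    where open ≤-Reasoning

  lower-half : ∀ M k t → 2 ^ suc M ℕ.* suc k ℕ.+ t ≡ 2 ^ M ℕ.* suc (1 ℕ.+ 2 ℕ.* k) ℕ.+ t
  lower-half M = lemma (2 ^ M)
    where
    lemma : ∀ P k t → 2 ℕ.* P ℕ.* suc k ℕ.+ t ≡ P ℕ.* suc (1 ℕ.+ 2 ℕ.* k) ℕ.+ t
    lemma = solve-∀

  upper-half : ∀ M k t → 2 ^ suc M ℕ.* suc k ℕ.+ (2 ^ M ℕ.+ t) ≡ 2 ^ M ℕ.* suc (2 ℕ.+ 2 ℕ.* k) ℕ.+ t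
  upper-half M = lemma (2 ^ M)
    where
    lemma : ∀ P k t → 2 ℕ.* P ℕ.* suc k ℕ.+ (P ℕ.+ t) ≡ P ℕ.* suc (2 ℕ.+ 2 ℕ.* k) ℕ.+ t
    lemma = solve-∀

  <2*n⇒<n⊎n+ : ∀ n {t} → t < 2 ℕ.* n → t < n ⊎ Σ ℕ λ t′ → t′ < n × t ≡ n ℕ.+ t′
  <2*n⇒<n⊎n+ n {t} t<2n with t ℕ.<? n
  ... | yes t<n = inj₁ t<n
  ... | no  t≮n = inj₂ (t ∸ n , t∸n<n , sym n+[t∸n]≡t)
    where
    n+[t∸n]≡t : n ℕ.+ (t ∸ n) ≡ t
    n+[t∸n]≡t = ℕ.m+[n∸m]≡n (ℕ.≮⇒≥ t≮n)
    t∸n<n : t ∸ n < n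
    t∸n<n = ℕ.+-cancelˡ-< n (t ∸ n) n (subst₂ _<_ (sym n+[t∸n]≡t) (cong (n ℕ.+_) (ℕ.+-identityʳ n)) t<2n)

  -- On every block 2^M (k+1) + [0, 2^M) the maximum of g is attained at offset a or b, where g lies
  -- on the chord of g over [k, k+1] at the mirrored parameters q and 1 − q, raised by r.
  record Peaks (M a b : ℕ) : Set where
    field
      q r         : ℚ
      ½≤q         : ½ ≤ q
      q≤1         : q ≤ 1ℚ
      a<2^M       : a < 2 ^ M
      b<2^M       : b < 2 ^ M
      g[a]        : ∀ k → g (2 ^ M ℕ.* suc k ℕ.+ a) ≡ chord q k + r
      g[b]        : ∀ k → g (2 ^ M ℕ.* suc k ℕ.+ b) ≡ chord (1ℚ - q) k + r
      g≤g[a]⊔g[b] : ∀ k {t} → t < 2 ^ M →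
                    g (2 ^ M ℕ.* suc k ℕ.+ t) ≤ g (2 ^ M ℕ.* suc k ℕ.+ a) ⊔ g (2 ^ M ℕ.* suc k ℕ.+ b)

  module _ {M a b} (P : Peaks M a b) where

    open Peaks P

    g≤g[a] : ∀ k {t} → 0ℚ ≤ Δg k → t < 2 ^ M → g (2 ^ M ℕ.* suc k ℕ.+ t) ≤ g (2 ^ M ℕ.* suc k ℕ.+ a)
    g≤g[a] k 0≤Δ t< = ≤-trans (g≤g[a]⊔g[b] k t<) (≤-reflexive (p≥q⇒p⊔q≡p g[b]≤g[a]))
      where
      open ≤-Reasoning
      g[b]≤g[a] : g (2 ^ M ℕ.* suc k ℕ.+ b) ≤ g (2 ^ M ℕ.* suc k ℕ.+ a)
      g[b]≤g[a] = begin
        g (2 ^ M ℕ.* suc k ℕ.+ b)   ≡⟨ g[b] k ⟩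
        chord (1ℚ - q) k + r        ≤⟨ +-monoˡ-≤ r (chord-mono-≤ k (1-q≤q ½≤q) 0≤Δ) ⟩
        chord q k + r               ≡⟨ g[a] k ⟨
        g (2 ^ M ℕ.* suc k ℕ.+ a)   ∎

    g≤g[b] : ∀ k {t} → Δg k ≤ 0ℚ → t < 2 ^ M → g (2 ^ M ℕ.* suc k ℕ.+ t) ≤ g (2 ^ M ℕ.* suc k ℕ.+ b)
    g≤g[b] k Δ≤0 t< = ≤-trans (g≤g[a]⊔g[b] k t<) (≤-reflexive (p≤q⇒p⊔q≡q g[a]≤g[b]))
      where
      open ≤-Reasoning
      g[a]≤g[b] : g (2 ^ M ℕ.* suc k ℕ.+ a) ≤ g (2 ^ M ℕ.* suc k ℕ.+ b)
      g[a]≤g[b] = begin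
        g (2 ^ M ℕ.* suc k ℕ.+ a)   ≡⟨ g[a] k ⟩
        chord q k + r               ≤⟨ +-monoˡ-≤ r (chord-anti-≤ k (1-q≤q ½≤q) Δ≤0) ⟩
        chord (1ℚ - q) k + r        ≡⟨ g[b] k ⟨
        g (2 ^ M ℕ.* suc k ℕ.+ b)   ∎

  peaks-suc : ∀ {M a b} → Peaks M a b → Peaks (suc M) (2 ^ M ℕ.+ b) a
  peaks-suc {M} {a} {b} P = record
    { q           = 1ℚ - q * ½
    ; r           = r + q * ⅙
    ; ½≤q         = ½≤1-q*½ q≤1
    ; q≤1         = 1-q*½≤1 (≤-trans 0≤½ ½≤q)
    ; a<2^M       = ℕ.+-monoʳ-< (2 ^ M) (subst (b <_) (sym (ℕ.+-identityʳ (2 ^ M))) b<2^M)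
    ; b<2^M       = ℕ.<-≤-trans a<2^M (ℕ.m≤m+n (2 ^ M) _)
    ; g[a]        = λ k → trans (cong g (upper-half M k b)) (trans (g[b] (2 ℕ.+ 2 ℕ.* k)) (chord-2+2k q r k))
    ; g[b]        = λ k → trans (cong g (lower-half M k a)) (trans (g[a] (1 ℕ.+ 2 ℕ.* k)) (chord-1+2k q r k))
    ; g≤g[a]⊔g[b] = bound
    }
    where
    open Peaks P
    open ≤-Reasoning
    0≤½ : 0ℚ ≤ ½
    0≤½ = ≤ᵇ⇒≤ tt
    g⁺ : ℕ → ℕ → ℚ
    g⁺ k t = g (2 ^ suc M ℕ.* suc k ℕ.+ t)
    -- The operands of _⊔_ are given explicitly: inferring them makes Agda unfold g and _⊔_.
    bound-halves : ∀ k {t} → t < 2 ^ M ⊎ Σ ℕ (λ t′ → t′ < 2 ^ M × t ≡ 2 ^ M ℕ.+ t′) → g⁺ k t ≤ g⁺ k (2 ^ M ℕ.+ b) ⊔ g⁺ k a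
    bound-halves k {t} (inj₁ t<2^M) = begin
      g⁺ k t                                     ≡⟨ cong g (lower-half M k t) ⟩
      g (2 ^ M ℕ.* suc (1 ℕ.+ 2 ℕ.* k) ℕ.+ t)    ≤⟨ g≤g[a] P (1 ℕ.+ 2 ℕ.* k) (0≤Δg-1+2k k) t<2^M ⟩
      g (2 ^ M ℕ.* suc (1 ℕ.+ 2 ℕ.* k) ℕ.+ a)    ≡⟨ cong g (lower-half M k a) ⟨
      g⁺ k a                                     ≤⟨ p≤q⊔p (g⁺ k (2 ^ M ℕ.+ b)) (g⁺ k a) ⟩
      g⁺ k (2 ^ M ℕ.+ b) ⊔ g⁺ k a                ∎
    bound-halves k (inj₂ (t′ , t′<2^M , refl)) = begin
      g⁺ k (2 ^ M ℕ.+ t′)                        ≡⟨ cong g (upper-half M k t′) ⟩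
      g (2 ^ M ℕ.* suc (2 ℕ.+ 2 ℕ.* k) ℕ.+ t′)   ≤⟨ g≤g[b] P (2 ℕ.+ 2 ℕ.* k) (Δg-2+2k≤0 k) t′<2^M ⟩
      g (2 ^ M ℕ.* suc (2 ℕ.+ 2 ℕ.* k) ℕ.+ b)    ≡⟨ cong g (upper-half M k b) ⟨
      g⁺ k (2 ^ M ℕ.+ b)                         ≤⟨ p≤p⊔q (g⁺ k (2 ^ M ℕ.+ b)) (g⁺ k a) ⟩
      g⁺ k (2 ^ M ℕ.+ b) ⊔ g⁺ k a                ∎
    bound : ∀ k {t} → t < 2 ^ suc M → g⁺ k t ≤ g⁺ k (2 ^ M ℕ.+ b) ⊔ g⁺ k a
    bound k t<2^[1+M] = bound-halves k (<2*n⇒<n⊎n+ (2 ^ M) t<2^[1+M])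

  peaks-1 : Peaks 1 0 0
  peaks-1 = record
    { q           = ½
    ; r           = ⅙
    ; ½≤q         = ≤-refl
    ; q≤1         = ≤ᵇ⇒≤ tt
    ; a<2^M       = ℕ.z<s
    ; b<2^M       = ℕ.z<s
    ; g[a]        = g[2+2k]
    ; g[b]        = g[2+2k]
    ; g≤g[a]⊔g[b] = bound
    }
    where
    index : ∀ k t → 2 ^ 1 ℕ.* suc k ℕ.+ t ≡ 2 ℕ.+ 2 ℕ.* k ℕ.+ t
    index = solve-∀
    g[2+2k] : ∀ k → g (2 ^ 1 ℕ.* suc k ℕ.+ 0) ≡ chord ½ k + ⅙
    g[2+2k] k = begin
      g (2 ^ 1 ℕ.* suc k ℕ.+ 0)     ≡⟨ cong g (trans (index k 0) (ℕ.+-identityʳ (2 ℕ.+ 2 ℕ.* k))) ⟩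
      g (2 ℕ.+ 2 ℕ.* k)             ≡⟨ g-2+2k k ⟩
      g k + Δg k * ½ + ⅙            ≡⟨ cong (λ x → g k + x + ⅙) (*-comm (Δg k) ½) ⟩
      chord ½ k + ⅙                 ∎
      where open ≡-Reasoning
    g₁ : ℕ → ℕ → ℚ
    g₁ k t = g (2 ^ 1 ℕ.* suc k ℕ.+ t)
    bound : ∀ k {t} → t < 2 ^ 1 → g₁ k t ≤ g₁ k 0 ⊔ g₁ k 0
    bound k {0} _ = p≤p⊔q (g₁ k 0) (g₁ k 0)
    bound k {1} _ = begin
      g₁ k 1                                    ≡⟨ cong g (trans (index k 1) (ℕ.+-comm (2 ℕ.+ 2 ℕ.* k) 1)) ⟩
      g (suc (2 ℕ.+ 2 ℕ.* k))                   ≡⟨ g-suc (2 ℕ.+ 2 ℕ.* k) ⟩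
      g (2 ℕ.+ 2 ℕ.* k) + Δg (2 ℕ.+ 2 ℕ.* k)    ≤⟨ +-monoʳ-≤ (g (2 ℕ.+ 2 ℕ.* k)) (Δg-2+2k≤0 k) ⟩
      g (2 ℕ.+ 2 ℕ.* k) + 0ℚ                    ≡⟨ +-identityʳ (g (2 ℕ.+ 2 ℕ.* k)) ⟩
      g (2 ℕ.+ 2 ℕ.* k)                         ≡⟨ cong g (trans (index k 0) (ℕ.+-identityʳ (2 ℕ.+ 2 ℕ.* k))) ⟨
      g₁ k 0                                    ≤⟨ p≤p⊔q (g₁ k 0) (g₁ k 0) ⟩
      g₁ k 0 ⊔ g₁ k 0                           ∎
      where open ≤-Reasoning
    bound k {suc (suc _)} (s≤s (s≤s ()))

  peak : ℕ → ℕ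
  peak 0             = 0
  peak 1             = 0
  peak (suc (suc M)) = 2 ^ suc M ℕ.+ peak M

  peaks : ∀ M → Peaks (suc M) (peak (suc M)) (peak M)
  peaks zero    = peaks-1
  peaks (suc M) = peaks-suc (peaks M)

  Λ-peaks : ∀ {M a b} k → Peaks M a b → Λ (suc k) M ≡ g (2 ^ M ℕ.* suc k ℕ.+ a) ⊔ g (2 ^ M ℕ.* suc k ℕ.+ b)
  Λ-peaks {M} {a} {b} k P = ≤-antisym
    (foldr-⊔-lub g[0]≤ (map⁺ (applyUpTo⁺₁ (λ t → t) (2 ^ M) (g≤g[a]⊔g[b] k))))
    (⊔-lub (≲-foldr-⊔ (g (2 ^ M ℕ.* suc k)) (∈-map⁺ block (∈-upTo⁺ a<2^M)))
           (≲-foldr-⊔ (g (2 ^ M ℕ.* suc k)) (∈-map⁺ block (∈-upTo⁺ b<2^M))))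
    where
    open Peaks P
    open FoldrMax ⊔-operator
    block : ℕ → ℚ
    block t = g (2 ^ M ℕ.* suc k ℕ.+ t)
    g[0]≤ : g (2 ^ M ℕ.* suc k) ≤ block a ⊔ block b
    g[0]≤ = subst (_≤ block a ⊔ block b) (cong g (ℕ.+-identityʳ (2 ^ M ℕ.* suc k))) (g≤g[a]⊔g[b] k (ℕ.≤-<-trans z≤n a<2^M))

open BlockMaxima using (Peaks; peak; peaks; Λ-peaks)
open import Data.Nat.Base using (_^_; _*_; _+_; _∸_)
open import Data.Nat.Properties using (*-suc; +-comm; m^n≢0)
open import Data.Nat.DivMod using (_/_; +-distrib-/-∣ʳ; m*n/n≡m)
open import Data.Nat.Divisibility using (n∣m*n)
open import Data.Nat.Tactic.RingSolver using (solve-∀)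
open import Data.Rational using (_⊔_)
open import Data.Rational.Properties using (⊔-comm)
open import Function.Base using (_∘_)

4n∸1≡[n∸1]+3n : ∀ n .{{_ : NonZero n}} → 2 * (2 * n) ∸ 1 ≡ (n ∸ 1) + n * 3
4n∸1≡[n∸1]+3n (suc n) = cong (_∸ 1) (lemma n)
  where
  lemma : ∀ n → 2 * (2 * suc n) ≡ suc (n + suc n * 3)
  lemma = solve-∀

x-suc : ∀ m → x (suc m) ≡ 2 ^ (1 + 2 * m) + x m
x-suc m = begin
  2 * ((2 ^ (2 * suc m) ∸ 1) / 3)      ≡⟨ cong (λ e → 2 * ((2 ^ e ∸ 1) / 3)) (*-suc 2 m) ⟩
  2 * ((2 * (2 * P) ∸ 1) / 3)          ≡⟨ cong (λ n → 2 * (n / 3)) (4n∸1≡[n∸1]+3n P {{m^n≢0 2 (2 * m)}}) ⟩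
  2 * (((P ∸ 1) + P * 3) / 3)          ≡⟨ cong (2 *_) (+-distrib-/-∣ʳ (P ∸ 1) (n∣m*n P)) ⟩
  2 * ((P ∸ 1) / 3 + P * 3 / 3)        ≡⟨ cong (λ n → 2 * ((P ∸ 1) / 3 + n)) (m*n/n≡m P 3) ⟩
  2 * ((P ∸ 1) / 3 + P)                ≡⟨ lemma ((P ∸ 1) / 3) P ⟩
  2 * P + 2 * ((P ∸ 1) / 3)            ∎
  where
  open ≡-Reasoning
  P : ℕ
  P = 2 ^ (2 * m)
  lemma : ∀ a b → 2 * (a + b) ≡ 2 * b + 2 * a
  lemma = solve-∀

y-suc : ∀ m → y (suc m) ≡ 2 ^ (2 + 2 * m) + y m
y-suc m = trans (cong (2 *_) (x-suc m)) (lemma (2 ^ (2 * m)) (x m))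
  where
  lemma : ∀ P a → 2 * (2 * P + a) ≡ 2 * (2 * P) + 2 * a
  lemma = solve-∀

peak-2m : ∀ m → peak (2 * m) ≡ x m
peak-2m zero    = refl
peak-2m (suc m) = trans (cong peak (*-suc 2 m)) (trans (cong (2 ^ (1 + 2 * m) +_) (peak-2m m)) (sym (x-suc m)))

peak-1+2m : ∀ m → peak (1 + 2 * m) ≡ y m
peak-1+2m zero    = refl
peak-1+2m (suc m) = trans (cong (peak ∘ suc) (*-suc 2 m)) (trans (cong (2 ^ (2 + 2 * m) +_) (peak-1+2m m)) (sym (y-suc m)))

theorem3 : (n : ℕ) → .{{_ : NonZero n}} → (m : ℕ) →
    (Λ n (2 * m + 1) ≡ g (2 ^ (2 * m + 1) * n + y m) ⊔ g (2 ^ (2 * m + 1) * n + x m))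
    × (Λ n (2 * m + 2) ≡ g (2 ^ (2 * m + 2) * n + y m) ⊔ g (2 ^ (2 * m + 2) * n + x (m + 1)))
theorem3 (suc k) m = odd-level , even-level
  where
  odd-level : Λ (suc k) (2 * m + 1) ≡ g (2 ^ (2 * m + 1) * suc k + y m) ⊔ g (2 ^ (2 * m + 1) * suc k + x m)
  odd-level = subst (λ L → Λ (suc k) L ≡ g (2 ^ L * suc k + y m) ⊔ g (2 ^ L * suc k + x m)) (+-comm 1 (2 * m))
    (Λ-peaks k (subst₂ (Peaks (1 + 2 * m)) (peak-1+2m m) (peak-2m m) (peaks (2 * m))))
  x[m+1] : peak (2 + 2 * m) ≡ x (m + 1)
  x[m+1] = trans (cong peak (sym (*-suc 2 m))) (trans (peak-2m (suc m)) (cong x (+-comm 1 m)))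
  even-level : Λ (suc k) (2 * m + 2) ≡ g (2 ^ (2 * m + 2) * suc k + y m) ⊔ g (2 ^ (2 * m + 2) * suc k + x (m + 1))
  even-level = subst (λ L → Λ (suc k) L ≡ g (2 ^ L * suc k + y m) ⊔ g (2 ^ L * suc k + x (m + 1))) (+-comm 2 (2 * m))
    (trans (Λ-peaks k (subst₂ (Peaks (2 + 2 * m)) x[m+1] (peak-1+2m m) (peaks (1 + 2 * m))))
           (⊔-comm (g (2 ^ (2 + 2 * m) * suc k + x (m + 1))) (g (2 ^ (2 + 2 * m) * suc k + y m))))
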